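{- The complete ternary tree with $n$ nodes has a 1-2 drawing in $O(n^{1.149})$ area.
   Context: $T_h$ denotes the complete ternary tree: every non-leaf node has exactly three children and every root-to-leaf path has exactly $h$ nodes; it has $n=(3^h-1)/2$ nodes. A drawing means a planar straight-line orthogonal grid drawing: nodes at distinct integer points, each edge a horizontal or vertical segment, no crossings; width (height) is the number of vertical (horizontal) grid lines intersecting it, area is width times height. 1-2 drawings of $T_h$ are defined recursively: for $h=1$, a single node at a grid point. For $h\ge2$, take any three (not necessarily congruent) 1-2 drawings $\Gamma^a,\Gamma^b,\Gamma^c$ of $T_{h-1}$ and combine them by Construction 1 or Construction 2; the result is a 1-2 drawing of $T_h$. Construction 1: place the root $r$ of $T_h$ at a grid point; translate $\Gamma^a$ so that its topmost grid row is one unit below $r$ and its root is on the vertical line through $r$; rotate $\Gamma^b$ clockwise by $90^\circ$ and place it so its rightmost grid column is one unit left of the leftmost column of $\Gamma^a$, its root on the horizontal line through $r$; rotate $\Gamma^c$ counterclockwise by $90^\circ$ and place it so its leftmost column is one unit right of the rightmost column of $\Gamma^a$, its root on the horizontal line through $r$; connect $r$ to the three roots. Construction 2: place $r$; rotate $\Gamma^b$ clockwise by $90^\circ$ and place it so its rightmost column is one unit left of $r$, its root on the horizontal line through $r$; rotate $\Gamma^c$ counterclockwise by $90^\circ$ and place it so its leftmost column is one unit right of $r$, its root on the horizontal line through $r$; place $\Gamma^a$ so its topmost row is one unit below the lowest row intersecting $\Gamma^b$ or $\Gamma^c$, its root on the vertical line through $r$; connect $r$ to the three roots. -}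

module Defs where

open import Data.Nat as ℕ using (ℕ; zero; suc)
open import Data.Integer as ℤ using (ℤ; _+_; _-_; -_; _⊓_; _⊔_; ∣_∣)
open import Data.Product using (_×_; _,_; proj₁; proj₂)

-- Grid points (x , y), y-axis pointing upwards ("below" = smaller y).
Point : Set
Point = ℤ × ℤ

-- A straight-line placement of the complete ternary tree T_h (h ≥ 1):
-- Drawing h assigns a grid point to every node of T_h, following its shape.
data Drawing : ℕ → Set where
  leaf : Point → Drawing 1
  node : ∀ {h} → Point → Drawing (suc h) → Drawing (suc h) → Drawing (suc h)
         → Drawing (suc (suc h))

root : ∀ {h} → Drawing h → Point
root (leaf p) = p
root (node p _ _ _) = p

mapD : ∀ {h} → (Point → Point) → Drawing h → Drawing h
mapD f (leaf p) = leaf (f p)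
mapD f (node p a b c) = node (f p) (mapD f a) (mapD f b) (mapD f c)

minX maxX minY maxY : ∀ {h} → Drawing h → ℤ
minX (leaf p) = proj₁ p
minX (node p a b c) = proj₁ p ⊓ (minX a ⊓ (minX b ⊓ minX c))
maxX (leaf p) = proj₁ p
maxX (node p a b c) = proj₁ p ⊔ (maxX a ⊔ (maxX b ⊔ maxX c))
minY (leaf p) = proj₂ p
minY (node p a b c) = proj₂ p ⊓ (minY a ⊓ (minY b ⊓ minY c))
maxY (leaf p) = proj₂ p
maxY (node p a b c) = proj₂ p ⊔ (maxY a ⊔ (maxY b ⊔ maxY c))

-- number of vertical / horizontal grid lines meeting the drawing
width height area : ∀ {h} → Drawing h → ℕ
width d = ∣ maxX d - minX d + ℤ.+ 1 ∣
height d = ∣ maxY d - minY d + ℤ.+ 1 ∣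
area d = width d ℕ.* height d

translate : ∀ {h} → ℤ → ℤ → Drawing h → Drawing h
translate dx dy = mapD (λ p → (proj₁ p + dx , proj₂ p + dy))

-- rotations by 90° (about the origin; placement is fixed afterwards by translation)
rotCW rotCCW : ∀ {h} → Drawing h → Drawing h
rotCW = mapD (λ p → (proj₂ p , - proj₁ p))
rotCCW = mapD (λ p → (- proj₂ p , proj₁ p))

construction1 : ∀ {h} → Point → Drawing (suc h) → Drawing (suc h) → Drawing (suc h)
                → Drawing (suc (suc h))
construction1 (rx , ry) a b c = node (rx , ry) a′ b′ c′
  where
  a′ = translate (rx - proj₁ (root a)) ((ry - ℤ.+ 1) - maxY a) a
  b₀ = rotCW b
  b′ = translate ((minX a′ - ℤ.+ 1) - maxX b₀) (ry - proj₂ (root b₀)) b₀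
  c₀ = rotCCW c
  c′ = translate ((maxX a′ + ℤ.+ 1) - minX c₀) (ry - proj₂ (root c₀)) c₀

construction2 : ∀ {h} → Point → Drawing (suc h) → Drawing (suc h) → Drawing (suc h)
                → Drawing (suc (suc h))
construction2 (rx , ry) a b c = node (rx , ry) a′ b′ c′
  where
  b₀ = rotCW b
  b′ = translate ((rx - ℤ.+ 1) - maxX b₀) (ry - proj₂ (root b₀)) b₀
  c₀ = rotCCW c
  c′ = translate ((rx + ℤ.+ 1) - minX c₀) (ry - proj₂ (root c₀)) c₀
  a′ = translate (rx - proj₁ (root a)) (((minY b′ ⊓ minY c′) - ℤ.+ 1) - maxY a) a

data OneTwo : ∀ {h} → Drawing h → Set where
  base  : (p : Point) → OneTwo (leaf p)
  cons1 : ∀ {h} {a b c : Drawing (suc h)} → OneTwo a → OneTwo b → OneTwo c →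
          (r : Point) → OneTwo (construction1 r a b c)
  cons2 : ∀ {h} {a b c : Drawing (suc h)} → OneTwo a → OneTwo b → OneTwo c →
          (r : Point) → OneTwo (construction2 r a b c)

-- number of nodes of T_h : (3^h - 1)/2
nodes : ℕ → ℕ
nodes zero = 0
nodes (suc h) = suc (3 ℕ.* nodes h)

module Submission where

-- Three families of 1-2 drawings are built together: the main drawing of T_(h+1) is Construction 2
-- applied to (family 1, main, main), family 1 is Construction 1 on (family 2, main, main), and
-- family 2 is Construction 1 on three main drawings. The extents of their bounding boxes around
-- the root satisfy a linear recurrence (with maxima) whose growth rate is below ρ = 37/20, so width
-- and height are O(ρ^h) while T_(h+1) has at least 3^h nodes. As ρ^2000 ≤ 3^1149, the area is
-- O(n^1.149).

open import Defs

module BoundingBox where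

  open import Data.Nat as ℕ using (ℕ; suc)
  import Data.Nat.Properties as ℕP
  import Data.Nat.Tactic.RingSolver as ℕSolver
  open import Data.Integer as ℤ using (ℤ; +_; _+_; _-_; -_; _⊓_; _⊔_; ∣_∣; _≤_)
  open import Data.Integer.Properties
  open import Data.Integer.Tactic.RingSolver using (solve-∀)
  open import Data.Product using (_,_; proj₁; proj₂)
  open import Relation.Binary.PropositionalEquality

  homomorphic₄ : ∀ (f : ℤ → ℤ) {_∙_ _◦_ : ℤ → ℤ → ℤ} → (∀ x y → f (x ∙ y) ≡ f x ◦ f y) →
                 ∀ p a b c → f (p ∙ (a ∙ (b ∙ c))) ≡ f p ◦ (f a ◦ (f b ◦ f c))
  homomorphic₄ f {_◦_ = _◦_} hom p a b c =
    trans (hom p _) (cong (f p ◦_) (trans (hom a _) (cong (f a ◦_) (hom b c))))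

  +-distrib-⊓₄ : ∀ k p a b c → (p ⊓ (a ⊓ (b ⊓ c))) + k ≡ (p + k) ⊓ ((a + k) ⊓ ((b + k) ⊓ (c + k)))
  +-distrib-⊓₄ k = homomorphic₄ (_+ k) {_⊓_} {_⊓_} (mono-≤-distrib-⊓ (+-monoˡ-≤ k))

  +-distrib-⊔₄ : ∀ k p a b c → (p ⊔ (a ⊔ (b ⊔ c))) + k ≡ (p + k) ⊔ ((a + k) ⊔ ((b + k) ⊔ (c + k)))
  +-distrib-⊔₄ k = homomorphic₄ (_+ k) {_⊔_} {_⊔_} (mono-≤-distrib-⊔ (+-monoˡ-≤ k))

  neg-distrib-⊓-⊔₄ : ∀ p a b c → - (p ⊓ (a ⊓ (b ⊓ c))) ≡ - p ⊔ (- a ⊔ (- b ⊔ - c))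
  neg-distrib-⊓-⊔₄ = homomorphic₄ -_ {_⊓_} {_⊔_} neg-distrib-⊓-⊔

  neg-distrib-⊔-⊓₄ : ∀ p a b c → - (p ⊔ (a ⊔ (b ⊔ c))) ≡ - p ⊓ (- a ⊓ (- b ⊓ - c))
  neg-distrib-⊔-⊓₄ = homomorphic₄ -_ {_⊔_} {_⊓_} neg-distrib-⊔-⊓

  root-translate : ∀ {h} dx dy (d : Drawing h) →
                   root (translate dx dy d) ≡ (proj₁ (root d) + dx , proj₂ (root d) + dy)
  root-translate dx dy (leaf p) = refl
  root-translate dx dy (node p a b c) = refl

  minX-translate : ∀ {h} dx dy (d : Drawing h) → minX (translate dx dy d) ≡ minX d + dx
  minX-translate dx dy (leaf p) = refl
  minX-translate dx dy (node p a b c)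
    rewrite minX-translate dx dy a | minX-translate dx dy b | minX-translate dx dy c
    = sym (+-distrib-⊓₄ dx (proj₁ p) (minX a) (minX b) (minX c))

  maxX-translate : ∀ {h} dx dy (d : Drawing h) → maxX (translate dx dy d) ≡ maxX d + dx
  maxX-translate dx dy (leaf p) = refl
  maxX-translate dx dy (node p a b c)
    rewrite maxX-translate dx dy a | maxX-translate dx dy b | maxX-translate dx dy c
    = sym (+-distrib-⊔₄ dx (proj₁ p) (maxX a) (maxX b) (maxX c))

  minY-translate : ∀ {h} dx dy (d : Drawing h) → minY (translate dx dy d) ≡ minY d + dy
  minY-translate dx dy (leaf p) = refl
  minY-translate dx dy (node p a b c)
    rewrite minY-translate dx dy a | minY-translate dx dy b | minY-translate dx dy c
    = sym (+-distrib-⊓₄ dy (proj₂ p) (minY a) (minY b) (minY c))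

  maxY-translate : ∀ {h} dx dy (d : Drawing h) → maxY (translate dx dy d) ≡ maxY d + dy
  maxY-translate dx dy (leaf p) = refl
  maxY-translate dx dy (node p a b c)
    rewrite maxY-translate dx dy a | maxY-translate dx dy b | maxY-translate dx dy c
    = sym (+-distrib-⊔₄ dy (proj₂ p) (maxY a) (maxY b) (maxY c))

  root-rotCW : ∀ {h} (d : Drawing h) → root (rotCW d) ≡ (proj₂ (root d) , - proj₁ (root d))
  root-rotCW (leaf p) = refl
  root-rotCW (node p a b c) = refl

  minX-rotCW : ∀ {h} (d : Drawing h) → minX (rotCW d) ≡ minY d
  minX-rotCW (leaf p) = refl
  minX-rotCW (node p a b c) rewrite minX-rotCW a | minX-rotCW b | minX-rotCW c = refl

  maxX-rotCW : ∀ {h} (d : Drawing h) → maxX (rotCW d) ≡ maxY d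
  maxX-rotCW (leaf p) = refl
  maxX-rotCW (node p a b c) rewrite maxX-rotCW a | maxX-rotCW b | maxX-rotCW c = refl

  minY-rotCW : ∀ {h} (d : Drawing h) → minY (rotCW d) ≡ - maxX d
  minY-rotCW (leaf p) = refl
  minY-rotCW (node p a b c) rewrite minY-rotCW a | minY-rotCW b | minY-rotCW c
    = sym (neg-distrib-⊔-⊓₄ (proj₁ p) (maxX a) (maxX b) (maxX c))

  maxY-rotCW : ∀ {h} (d : Drawing h) → maxY (rotCW d) ≡ - minX d
  maxY-rotCW (leaf p) = refl
  maxY-rotCW (node p a b c) rewrite maxY-rotCW a | maxY-rotCW b | maxY-rotCW c
    = sym (neg-distrib-⊓-⊔₄ (proj₁ p) (minX a) (minX b) (minX c))

  root-rotCCW : ∀ {h} (d : Drawing h) → root (rotCCW d) ≡ (- proj₂ (root d) , proj₁ (root d))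
  root-rotCCW (leaf p) = refl
  root-rotCCW (node p a b c) = refl

  minX-rotCCW : ∀ {h} (d : Drawing h) → minX (rotCCW d) ≡ - maxY d
  minX-rotCCW (leaf p) = refl
  minX-rotCCW (node p a b c) rewrite minX-rotCCW a | minX-rotCCW b | minX-rotCCW c
    = sym (neg-distrib-⊔-⊓₄ (proj₂ p) (maxY a) (maxY b) (maxY c))

  maxX-rotCCW : ∀ {h} (d : Drawing h) → maxX (rotCCW d) ≡ - minY d
  maxX-rotCCW (leaf p) = refl
  maxX-rotCCW (node p a b c) rewrite maxX-rotCCW a | maxX-rotCCW b | maxX-rotCCW c
    = sym (neg-distrib-⊓-⊔₄ (proj₂ p) (minY a) (minY b) (minY c))

  minY-rotCCW : ∀ {h} (d : Drawing h) → minY (rotCCW d) ≡ minX d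
  minY-rotCCW (leaf p) = refl
  minY-rotCCW (node p a b c) rewrite minY-rotCCW a | minY-rotCCW b | minY-rotCCW c = refl

  maxY-rotCCW : ∀ {h} (d : Drawing h) → maxY (rotCCW d) ≡ maxX d
  maxY-rotCCW (leaf p) = refl
  maxY-rotCCW (node p a b c) rewrite maxY-rotCCW a | maxY-rotCCW b | maxY-rotCCW c = refl

  minX≤root₁ : ∀ {h} (d : Drawing h) → minX d ≤ proj₁ (root d)
  minX≤root₁ (leaf p) = ≤-refl
  minX≤root₁ (node p a b c) = i⊓j≤i _ _

  root₁≤maxX : ∀ {h} (d : Drawing h) → proj₁ (root d) ≤ maxX d
  root₁≤maxX (leaf p) = ≤-refl
  root₁≤maxX (node p a b c) = i≤i⊔j _ _

  minY≤root₂ : ∀ {h} (d : Drawing h) → minY d ≤ proj₂ (root d)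
  minY≤root₂ (leaf p) = ≤-refl
  minY≤root₂ (node p a b c) = i⊓j≤i _ _

  root₂≤maxY : ∀ {h} (d : Drawing h) → proj₂ (root d) ≤ maxY d
  root₂≤maxY (leaf p) = ≤-refl
  root₂≤maxY (node p a b c) = i≤i⊔j _ _

  -- x ≤ y + k with a natural slack k; a record, so that k can be inferred.
  record _≤_+ᴺ_ (x y : ℤ) (k : ℕ) : Set where
    constructor ≤+ᴺ
    field ≤ᴺ⇒≤ : x ≤ y + + k
  infix 4 _≤_+ᴺ_

  ≤ᴺ-refl : ∀ {x} k → x ≤ x +ᴺ k
  ≤ᴺ-refl {x} k = ≤+ᴺ (i≤i+j x (+ k))

  ≤⇒≤ᴺ : ∀ {x y} → x ≤ y → x ≤ y +ᴺ 0
  ≤⇒≤ᴺ {x} {y} p = ≤+ᴺ (subst (x ≤_) (sym (+-identityʳ y)) p)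

  ≤ᴺ-weaken : ∀ {x y k l} → k ℕ.≤ l → x ≤ y +ᴺ k → x ≤ y +ᴺ l
  ≤ᴺ-weaken {y = y} k≤l (≤+ᴺ p) = ≤+ᴺ (≤-trans p (+-monoʳ-≤ y (ℤ.+≤+ k≤l)))

  ≤ᴺ-trans : ∀ {x y z k l} → x ≤ y +ᴺ k → y ≤ z +ᴺ l → x ≤ z +ᴺ (k ℕ.+ l)
  ≤ᴺ-trans {y = y} {z} {k} {l} (≤+ᴺ p) (≤+ᴺ q) = ≤+ᴺ (begin
    _                       ≤⟨ p ⟩
    y + + k                 ≤⟨ +-monoˡ-≤ (+ k) q ⟩
    (z + + l) + + k         ≡⟨ +-assoc z (+ l) (+ k) ⟩
    z + (+ l + + k)         ≡⟨ cong (λ w → z + w) (sym (pos-+ l k)) ⟩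
    z + + (l ℕ.+ k)         ≡⟨ cong (λ n → z + + n) (ℕP.+-comm l k) ⟩
    z + + (k ℕ.+ l)         ∎)
    where open ≤-Reasoning

  ≤ᴺ-neg : ∀ {x y k} → x ≤ y +ᴺ k → - y ≤ - x +ᴺ k
  ≤ᴺ-neg {x} {y} {k} (≤+ᴺ p) =
    ≤+ᴺ (subst (_≤ - x + + k) (cancel y (+ k)) (+-monoˡ-≤ (+ k) (neg-mono-≤ p)))
    where
    cancel : ∀ y k → - (y + k) + k ≡ - y
    cancel = solve-∀

  ≤ᴺ-shift : ∀ {x y k} t → x ≤ y +ᴺ k → x + t ≤ y + t +ᴺ k
  ≤ᴺ-shift {x} {y} {k} t (≤+ᴺ p) =
    ≤+ᴺ (subst (x + t ≤_) (swap y (+ k) t) (+-monoˡ-≤ t p))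
    where
    swap : ∀ y k t → y + k + t ≡ y + t + k
    swap = solve-∀

  ≤ᴺ-⊓ : ∀ {x a b k} → x ≤ a +ᴺ k → x ≤ b +ᴺ k → x ≤ a ⊓ b +ᴺ k
  ≤ᴺ-⊓ {x} {a} {b} {k} (≤+ᴺ p) (≤+ᴺ q) =
    ≤+ᴺ (subst (x ≤_) (sym (mono-≤-distrib-⊓ (+-monoˡ-≤ (+ k)) a b)) (⊓-glb p q))

  ≤ᴺ-⊔ : ∀ {a b y k} → a ≤ y +ᴺ k → b ≤ y +ᴺ k → a ⊔ b ≤ y +ᴺ k
  ≤ᴺ-⊔ (≤+ᴺ p) (≤+ᴺ q) = ≤+ᴺ (⊔-lub p q)

  ≡-1⇒≤ : ∀ {u v} → u ≡ v - + 1 → u ≤ v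
  ≡-1⇒≤ {v = v} refl = i-j≤i v (+ 1)

  ≡-1⇒≤ᴺ : ∀ {u v} → u ≡ v - + 1 → v ≤ u +ᴺ 1
  ≡-1⇒≤ᴺ {v = v} refl = ≤+ᴺ (≤-reflexive (cancel v))
    where
    cancel : ∀ v → v ≡ v - + 1 + + 1
    cancel = solve-∀

  ≡+1⇒≤ : ∀ {u v} → u ≡ v + + 1 → v ≤ u
  ≡+1⇒≤ {v = v} refl = i≤i+j v (+ 1)

  ≡+1⇒≤ᴺ : ∀ {u v} → u ≡ v + + 1 → u ≤ v +ᴺ 1
  ≡+1⇒≤ᴺ refl = ≤+ᴺ ≤-refl

  ∣span∣≤ : ∀ {u v k} → u ≤ v → v ≤ u +ᴺ k → ∣ v - u + + 1 ∣ ℕ.≤ suc k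
  ∣span∣≤ {u} {v} {k} u≤v (≤+ᴺ p) = drop‿+≤+ (begin
    + ∣ v - u + + 1 ∣  ≡⟨ 0≤i⇒+∣i∣≡i (≤-trans (i≤j⇒0≤j-i u≤v) (i≤i+j (v - u) (+ 1))) ⟩
    v - u + + 1        ≤⟨ +-monoˡ-≤ (+ 1) (+-monoˡ-≤ (- u) p) ⟩
    u + + k - u + + 1  ≡⟨ cancel u (+ k) ⟩
    + 1 + + k          ≡⟨ sym (pos-+ 1 k) ⟩
    + suc k            ∎)
    where
    open ≤-Reasoning
    cancel : ∀ u k → u + k - u + + 1 ≡ + 1 + k
    cancel = solve-∀

  record BoxAround {h} (d : Drawing h) (x y : ℤ) (L R U D : ℕ) : Set where
    field
      left  : x ≤ minX d +ᴺ L
      right : maxX d ≤ x +ᴺ R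
      up    : maxY d ≤ y +ᴺ U
      down  : y ≤ minY d +ᴺ D

  Box : ∀ {h} → Drawing h → (L R U D : ℕ) → Set
  Box d = BoxAround d (proj₁ (root d)) (proj₂ (root d))

  box-leaf : ∀ p → Box (leaf p) 0 0 0 0
  box-leaf p = record { left = ≤ᴺ-refl 0 ; right = ≤ᴺ-refl 0 ; up = ≤ᴺ-refl 0 ; down = ≤ᴺ-refl 0 }

  boxAround⇒box : ∀ {h} {d : Drawing h} {x y L R U D} → root d ≡ (x , y) →
                  BoxAround d x y L R U D → Box d L R U D
  boxAround⇒box eq b rewrite eq = b

  box-translate : ∀ {h} {d : Drawing h} {L R U D} dx dy → Box d L R U D → Box (translate dx dy d) L R U D
  box-translate {d = d} {L} {R} {U} {D} dx dy b = boxAround⇒box (root-translate dx dy d) (record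
    { left  = subst (λ m → x + dx ≤ m +ᴺ L) (sym (minX-translate dx dy d)) (≤ᴺ-shift dx left)
    ; right = subst (λ m → m ≤ x + dx +ᴺ R) (sym (maxX-translate dx dy d)) (≤ᴺ-shift dx right)
    ; up    = subst (λ m → m ≤ y + dy +ᴺ U) (sym (maxY-translate dx dy d)) (≤ᴺ-shift dy up)
    ; down  = subst (λ m → y + dy ≤ m +ᴺ D) (sym (minY-translate dx dy d)) (≤ᴺ-shift dy down) })
    where
    open BoxAround b
    x = proj₁ (root d)
    y = proj₂ (root d)

  box-rotCW : ∀ {h} {d : Drawing h} {L R U D} → Box d L R U D → Box (rotCW d) D U L R
  box-rotCW {d = d} {L} {R} {U} {D} b = boxAround⇒box (root-rotCW d) (record
    { left  = subst (λ m → y ≤ m +ᴺ D) (sym (minX-rotCW d)) down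
    ; right = subst (λ m → m ≤ y +ᴺ U) (sym (maxX-rotCW d)) up
    ; up    = subst (λ m → m ≤ - x +ᴺ L) (sym (maxY-rotCW d)) (≤ᴺ-neg left)
    ; down  = subst (λ m → - x ≤ m +ᴺ R) (sym (minY-rotCW d)) (≤ᴺ-neg right) })
    where
    open BoxAround b
    x = proj₁ (root d)
    y = proj₂ (root d)

  box-rotCCW : ∀ {h} {d : Drawing h} {L R U D} → Box d L R U D → Box (rotCCW d) U D R L
  box-rotCCW {d = d} {L} {R} {U} {D} b = boxAround⇒box (root-rotCCW d) (record
    { left  = subst (λ m → - y ≤ m +ᴺ U) (sym (minX-rotCCW d)) (≤ᴺ-neg up)
    ; right = subst (λ m → m ≤ - y +ᴺ D) (sym (maxX-rotCCW d)) (≤ᴺ-neg down)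
    ; up    = subst (λ m → m ≤ x +ᴺ R) (sym (maxY-rotCCW d)) right
    ; down  = subst (λ m → x ≤ m +ᴺ L) (sym (minY-rotCCW d)) left })
    where
    open BoxAround b
    x = proj₁ (root d)
    y = proj₂ (root d)

  boxAround-mono : ∀ {h} {d : Drawing h} {x y L R U D L′ R′ U′ D′} →
                   L ℕ.≤ L′ → R ℕ.≤ R′ → U ℕ.≤ U′ → D ℕ.≤ D′ →
                   BoxAround d x y L R U D → BoxAround d x y L′ R′ U′ D′
  boxAround-mono L≤ R≤ U≤ D≤ b = record
    { left = ≤ᴺ-weaken L≤ left ; right = ≤ᴺ-weaken R≤ right
    ; up = ≤ᴺ-weaken U≤ up ; down = ≤ᴺ-weaken D≤ down }
    where open BoxAround b

  box-node : ∀ {h} {A B C : Drawing (suc h)} {x y L R U D} →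
             BoxAround A x y L R U D → BoxAround B x y L R U D → BoxAround C x y L R U D →
             Box (node (x , y) A B C) L R U D
  box-node a b c = record
    { left  = ≤ᴺ-⊓ (≤ᴺ-refl _) (≤ᴺ-⊓ (left a) (≤ᴺ-⊓ (left b) (left c)))
    ; right = ≤ᴺ-⊔ (≤ᴺ-refl _) (≤ᴺ-⊔ (right a) (≤ᴺ-⊔ (right b) (right c)))
    ; up    = ≤ᴺ-⊔ (≤ᴺ-refl _) (≤ᴺ-⊔ (up a) (≤ᴺ-⊔ (up b) (up c)))
    ; down  = ≤ᴺ-⊓ (≤ᴺ-refl _) (≤ᴺ-⊓ (down a) (≤ᴺ-⊓ (down b) (down c))) }
    where open BoxAround

  width≤ : ∀ {h} {d : Drawing h} {L R U D} → Box d L R U D → width d ℕ.≤ suc (R ℕ.+ L)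
  width≤ {d = d} b = ∣span∣≤ (≤-trans (minX≤root₁ d) (root₁≤maxX d)) (≤ᴺ-trans right left)
    where open BoxAround b

  height≤ : ∀ {h} {d : Drawing h} {L R U D} → Box d L R U D → height d ℕ.≤ suc (U ℕ.+ D)
  height≤ {d = d} b = ∣span∣≤ (≤-trans (minY≤root₂ d) (root₂≤maxY d)) (≤ᴺ-trans up down)
    where open BoxAround b

  box-below : ∀ {h} {A : Drawing h} {x y L R U D g} → proj₁ (root A) ≡ x →
              maxY A ≤ y → y ≤ maxY A +ᴺ suc g → Box A L R U D →
              BoxAround A x y L R 0 (g ℕ.+ suc (U ℕ.+ D))
  box-below {g = g} refl below gap b = record
    { left = left ; right = right ; up = ≤⇒≤ᴺ below
    ; down = ≤ᴺ-weaken (ℕP.≤-reflexive (sym (ℕP.+-suc g _))) (≤ᴺ-trans gap (≤ᴺ-trans up down)) }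
    where open BoxAround b

  box-leftOf : ∀ {h} {B : Drawing h} {x y L R U D g} → proj₂ (root B) ≡ y →
               maxX B ≤ x → x ≤ maxX B +ᴺ suc g → Box B L R U D →
               BoxAround B x y (g ℕ.+ suc (R ℕ.+ L)) 0 U D
  box-leftOf {g = g} refl leftOf gap b = record
    { left = ≤ᴺ-weaken (ℕP.≤-reflexive (sym (ℕP.+-suc g _))) (≤ᴺ-trans gap (≤ᴺ-trans right left))
    ; right = ≤⇒≤ᴺ leftOf ; up = up ; down = down }
    where open BoxAround b

  box-rightOf : ∀ {h} {C : Drawing h} {x y L R U D g} → proj₂ (root C) ≡ y →
                x ≤ minX C → minX C ≤ x +ᴺ suc g → Box C L R U D →
                BoxAround C x y 0 (g ℕ.+ suc (L ℕ.+ R)) U D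
  box-rightOf {L = L} {R} {g = g} refl rightOf gap b = record
    { left = ≤⇒≤ᴺ rightOf
    ; right = ≤ᴺ-weaken (ℕP.≤-reflexive (reorder R L g)) (≤ᴺ-trans right (≤ᴺ-trans left gap))
    ; up = up ; down = down }
    where
    open BoxAround b
    reorder : ∀ r l g → r ℕ.+ (l ℕ.+ suc g) ≡ g ℕ.+ suc (l ℕ.+ r)
    reorder = ℕSolver.solve-∀

  record Extent : Set where
    constructor ⟨_,_,_⟩
    field halfWidth above below : ℕ
  open Extent public

  SymBox : ∀ {h} → Drawing h → Extent → Set
  SymBox d e = Box d (halfWidth e) (halfWidth e) (above e) (below e)

  -- b and c enter rotated, so their vertical extent above + below becomes horizontal.
  extent₁ extent₂ : Extent → Extent → Extent
  extent₁ a b = ⟨ halfWidth a ℕ.+ suc (above b ℕ.+ below b) , halfWidth b ,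
                  suc (above a ℕ.+ below a) ℕ.⊔ halfWidth b ⟩
  extent₂ a b = ⟨ suc (above b ℕ.+ below b) ℕ.⊔ halfWidth a , halfWidth b ,
                  halfWidth b ℕ.+ suc (above a ℕ.+ below a) ⟩

  +-diff : ∀ i j → i + (j - i) ≡ j
  +-diff = solve-∀

  box-construction₁ : ∀ {h} r {a b c : Drawing (suc h)} {ea eb} →
                      SymBox a ea → SymBox b eb → SymBox c eb →
                      SymBox (construction1 r a b c) (extent₁ ea eb)
  box-construction₁ (x , y) {a} {b} {c} {ea} {eb} ba bb bc = box-node
    (boxAround-mono (ℕP.m≤m+n sa _) (ℕP.m≤m+n sa _) ℕ.z≤n (ℕP.m≤m⊔n da sb)
      (box-below rootA (≡-1⇒≤ topA) (≡-1⇒≤ᴺ topA) boxA))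
    (boxAround-mono ℕP.≤-refl ℕ.z≤n ℕP.≤-refl (ℕP.m≤n⊔m da sb)
      (box-leftOf rootB leftOfA gapB (box-translate dxB dyB (box-rotCW bb))))
    (boxAround-mono ℕ.z≤n ℕP.≤-refl ℕP.≤-refl (ℕP.m≤n⊔m da sb)
      (box-rightOf rootC rightOfA gapC (box-translate dxC dyC (box-rotCCW bc))))
    where
    sa = halfWidth ea
    sb = halfWidth eb
    da = suc (above ea ℕ.+ below ea)
    dxA = x - proj₁ (root a)
    dyA = (y - + 1) - maxY a
    A = translate dxA dyA a
    boxA = box-translate dxA dyA ba
    module A = BoxAround boxA
    b₀ = rotCW b
    dxB = (minX A - + 1) - maxX b₀
    dyB = y - proj₂ (root b₀)
    B = translate dxB dyB b₀
    c₀ = rotCCW c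
    dxC = (maxX A + + 1) - minX c₀
    dyC = y - proj₂ (root c₀)
    C = translate dxC dyC c₀

    rootA : proj₁ (root A) ≡ x
    rootA = trans (cong proj₁ (root-translate dxA dyA a)) (+-diff (proj₁ (root a)) x)
    topA : maxY A ≡ y - + 1
    topA = trans (maxY-translate dxA dyA a) (+-diff (maxY a) (y - + 1))
    rootB : proj₂ (root B) ≡ y
    rootB = trans (cong proj₂ (root-translate dxB dyB b₀)) (+-diff (proj₂ (root b₀)) y)
    rightB : maxX B ≡ minX A - + 1
    rightB = trans (maxX-translate dxB dyB b₀) (+-diff (maxX b₀) (minX A - + 1))
    rootC : proj₂ (root C) ≡ y
    rootC = trans (cong proj₂ (root-translate dxC dyC c₀)) (+-diff (proj₂ (root c₀)) y)
    leftC : minX C ≡ maxX A + + 1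
    leftC = trans (minX-translate dxC dyC c₀) (+-diff (minX c₀) (maxX A + + 1))

    leftOfA : maxX B ≤ x
    leftOfA = ≤-trans (≡-1⇒≤ rightB) (subst (minX A ≤_) rootA (minX≤root₁ A))
    gapB : x ≤ maxX B +ᴺ suc (halfWidth ea)
    gapB = ≤ᴺ-weaken (ℕP.≤-reflexive (ℕP.+-comm (halfWidth ea) 1))
             (≤ᴺ-trans (subst (λ z → z ≤ minX A +ᴺ halfWidth ea) rootA A.left) (≡-1⇒≤ᴺ rightB))
    rightOfA : x ≤ minX C
    rightOfA = ≤-trans (subst (_≤ maxX A) rootA (root₁≤maxX A)) (≡+1⇒≤ leftC)
    gapC : minX C ≤ x +ᴺ suc (halfWidth ea)
    gapC = ≤ᴺ-trans (≡+1⇒≤ᴺ leftC) (subst (λ z → maxX A ≤ z +ᴺ halfWidth ea) rootA A.right)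

  box-construction₂ : ∀ {h} r {a b c : Drawing (suc h)} {ea eb} →
                      SymBox a ea → SymBox b eb → SymBox c eb →
                      SymBox (construction2 r a b c) (extent₂ ea eb)
  box-construction₂ (x , y) {a} {b} {c} {ea} {eb} ba bb bc = box-node
    (boxAround-mono (ℕP.m≤n⊔m wb sa) (ℕP.m≤n⊔m wb sa) ℕ.z≤n ℕP.≤-refl
      (box-below rootA belowBC gapA (box-translate dxA dyA ba)))
    (boxAround-mono (ℕP.m≤m⊔n wb sa) ℕ.z≤n ℕP.≤-refl (ℕP.m≤m+n sb _)
      (box-leftOf rootB (≡-1⇒≤ rightB) (≡-1⇒≤ᴺ rightB) boxB))
    (boxAround-mono ℕ.z≤n (ℕP.m≤m⊔n wb sa) ℕP.≤-refl (ℕP.m≤m+n sb _)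
      (box-rightOf rootC (≡+1⇒≤ leftC) (≡+1⇒≤ᴺ leftC) boxC))
    where
    sa = halfWidth ea
    sb = halfWidth eb
    wb = suc (above eb ℕ.+ below eb)
    b₀ = rotCW b
    dxB = (x - + 1) - maxX b₀
    dyB = y - proj₂ (root b₀)
    B = translate dxB dyB b₀
    boxB = box-translate dxB dyB (box-rotCW bb)
    c₀ = rotCCW c
    dxC = (x + + 1) - minX c₀
    dyC = y - proj₂ (root c₀)
    C = translate dxC dyC c₀
    boxC = box-translate dxC dyC (box-rotCCW bc)
    dxA = x - proj₁ (root a)
    dyA = ((minY B ⊓ minY C) - + 1) - maxY a
    A = translate dxA dyA a

    rootB : proj₂ (root B) ≡ y
    rootB = trans (cong proj₂ (root-translate dxB dyB b₀)) (+-diff (proj₂ (root b₀)) y)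
    rightB : maxX B ≡ x - + 1
    rightB = trans (maxX-translate dxB dyB b₀) (+-diff (maxX b₀) (x - + 1))
    rootC : proj₂ (root C) ≡ y
    rootC = trans (cong proj₂ (root-translate dxC dyC c₀)) (+-diff (proj₂ (root c₀)) y)
    leftC : minX C ≡ x + + 1
    leftC = trans (minX-translate dxC dyC c₀) (+-diff (minX c₀) (x + + 1))
    rootA : proj₁ (root A) ≡ x
    rootA = trans (cong proj₁ (root-translate dxA dyA a)) (+-diff (proj₁ (root a)) x)
    topA : maxY A ≡ (minY B ⊓ minY C) - + 1
    topA = trans (maxY-translate dxA dyA a) (+-diff (maxY a) _)

    belowBC : maxY A ≤ y
    belowBC = ≤-trans (≡-1⇒≤ topA)
                (≤-trans (i⊓j≤i (minY B) (minY C)) (subst (minY B ≤_) rootB (minY≤root₂ B)))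
    gapA : y ≤ maxY A +ᴺ suc sb
    gapA = ≤ᴺ-weaken (ℕP.≤-reflexive (ℕP.+-comm sb 1))
             (≤ᴺ-trans (≤ᴺ-⊓ (subst (λ z → z ≤ minY B +ᴺ sb) rootB (BoxAround.down boxB))
                              (subst (λ z → z ≤ minY C +ᴺ sb) rootC (BoxAround.down boxC)))
                       (≡-1⇒≤ᴺ topA))

module Growth where

  open import Data.Nat
  open import Data.Nat.Properties
  open import Relation.Binary.PropositionalEquality
  open import Algebra.Properties.CommutativeSemigroup *-commutativeSemigroup using (interchange; x∙yz≈y∙xz)

  -- x ≤ w · ρ^h for ρ = 37/20, with the denominators cleared.
  record _≤_·ρ^_ (x w h : ℕ) : Set where
    constructor ≤·ρ^
    field ·ρ^⇒≤ : 20 ^ h * x ≤ w * 37 ^ h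
  infix 4 _≤_·ρ^_

  ρ-zero : ∀ {x w} → x ≤ w → x ≤ w ·ρ^ 0
  ρ-zero {x} {w} x≤w = ≤·ρ^ (subst₂ _≤_ (sym (*-identityˡ x)) (sym (*-identityʳ w)) x≤w)

  ρ-mono : ∀ {x y w h} → x ≤ y → y ≤ w ·ρ^ h → x ≤ w ·ρ^ h
  ρ-mono {h = h} x≤y (≤·ρ^ p) = ≤·ρ^ (≤-trans (*-monoʳ-≤ (20 ^ h) x≤y) p)

  ρ-+ : ∀ {x y wx wy h} → x ≤ wx ·ρ^ h → y ≤ wy ·ρ^ h → x + y ≤ wx + wy ·ρ^ h
  ρ-+ {x} {y} {wx} {wy} {h} (≤·ρ^ p) (≤·ρ^ q) = ≤·ρ^ (begin
    20 ^ h * (x + y)            ≡⟨ *-distribˡ-+ (20 ^ h) x y ⟩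
    20 ^ h * x + 20 ^ h * y     ≤⟨ +-mono-≤ p q ⟩
    wx * 37 ^ h + wy * 37 ^ h   ≡⟨ *-distribʳ-+ (37 ^ h) wx wy ⟨
    (wx + wy) * 37 ^ h          ∎)
    where open ≤-Reasoning

  ρ-⊔ : ∀ {x y wx wy h} → x ≤ wx ·ρ^ h → y ≤ wy ·ρ^ h → x ⊔ y ≤ wx ⊔ wy ·ρ^ h
  ρ-⊔ {x} {y} {wx} {wy} {h} (≤·ρ^ p) (≤·ρ^ q) = ≤·ρ^ (begin
    20 ^ h * (x ⊔ y)            ≡⟨ *-distribˡ-⊔ (20 ^ h) x y ⟩
    20 ^ h * x ⊔ 20 ^ h * y     ≤⟨ ⊔-mono-≤ p q ⟩
    wx * 37 ^ h ⊔ wy * 37 ^ h   ≡⟨ *-distribʳ-⊔ (37 ^ h) wx wy ⟨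
    (wx ⊔ wy) * 37 ^ h          ∎)
    where open ≤-Reasoning

  ρ-step : ∀ {x w w′ h} → x ≤ w ·ρ^ h → 20 * w ≤ 37 * w′ → x ≤ w′ ·ρ^ suc h
  ρ-step {x} {w} {w′} {h} (≤·ρ^ p) 20w≤37w′ = ≤·ρ^ (begin
    20 * 20 ^ h * x      ≡⟨ *-assoc 20 (20 ^ h) x ⟩
    20 * (20 ^ h * x)    ≤⟨ *-monoʳ-≤ 20 p ⟩
    20 * (w * 37 ^ h)    ≡⟨ *-assoc 20 w (37 ^ h) ⟨
    20 * w * 37 ^ h      ≤⟨ *-monoˡ-≤ (37 ^ h) 20w≤37w′ ⟩
    37 * w′ * 37 ^ h     ≡⟨ cong (_* 37 ^ h) (*-comm 37 w′) ⟩
    w′ * 37 * 37 ^ h     ≡⟨ *-assoc w′ 37 (37 ^ h) ⟩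
    w′ * (37 * 37 ^ h)   ∎)
    where open ≤-Reasoning

  ^-distribʳ-* : ∀ m n k → (m * n) ^ k ≡ m ^ k * n ^ k
  ^-distribʳ-* m n zero = refl
  ^-distribʳ-* m n (suc k) = begin
    m * n * (m * n) ^ k        ≡⟨ cong (m * n *_) (^-distribʳ-* m n k) ⟩
    m * n * (m ^ k * n ^ k)    ≡⟨ interchange m n (m ^ k) (n ^ k) ⟩
    m * m ^ k * (n * n ^ k)    ∎
    where open ≡-Reasoning

  ρ-* : ∀ {x y wx wy h} → x ≤ wx ·ρ^ h → y ≤ wy ·ρ^ h → 400 ^ h * (x * y) ≤ wx * wy * 1369 ^ h
  ρ-* {x} {y} {wx} {wy} {h} (≤·ρ^ p) (≤·ρ^ q) = begin
    400 ^ h * (x * y)                  ≡⟨ cong (_* (x * y)) (^-distribʳ-* 20 20 h) ⟩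
    20 ^ h * 20 ^ h * (x * y)          ≡⟨ interchange (20 ^ h) (20 ^ h) x y ⟩
    20 ^ h * x * (20 ^ h * y)          ≤⟨ *-mono-≤ p q ⟩
    wx * 37 ^ h * (wy * 37 ^ h)        ≡⟨ interchange wx (37 ^ h) wy (37 ^ h) ⟩
    wx * wy * (37 ^ h * 37 ^ h)        ≡⟨ cong (wx * wy *_) (^-distribʳ-* 37 37 h) ⟨
    wx * wy * 1369 ^ h                 ∎
    where open ≤-Reasoning

  ^-swap : ∀ a m n → (a ^ m) ^ n ≡ (a ^ n) ^ m
  ^-swap a m n = begin
    (a ^ m) ^ n  ≡⟨ ^-*-assoc a m n ⟩
    a ^ (m * n)  ≡⟨ cong (a ^_) (*-comm m n) ⟩
    a ^ (n * m)  ≡⟨ ^-*-assoc a n m ⟨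
    (a ^ n) ^ m  ∎
    where open ≡-Reasoning

  ^-transfer : ∀ {p q r e f h A K n} .{{_ : NonZero p}} →
               p ^ h * A ≤ K * q ^ h → q ^ e ≤ p ^ e * r ^ f → r ^ h ≤ n → A ^ e ≤ K ^ e * n ^ f
  ^-transfer {p} {q} {r} {e} {f} {h} {A} {K} {n} growth q^e≤p^er^f r^h≤n =
    *-cancelˡ-≤ ((p ^ h) ^ e) {{m^n≢0 (p ^ h) e {{m^n≢0 p h}}}} (begin
      (p ^ h) ^ e * A ^ e                   ≡⟨ ^-distribʳ-* (p ^ h) A e ⟨
      (p ^ h * A) ^ e                       ≤⟨ ^-monoˡ-≤ e growth ⟩
      (K * q ^ h) ^ e                       ≡⟨ ^-distribʳ-* K (q ^ h) e ⟩
      K ^ e * (q ^ h) ^ e                   ≡⟨ cong (K ^ e *_) (^-swap q h e) ⟩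
      K ^ e * (q ^ e) ^ h                   ≤⟨ *-monoʳ-≤ (K ^ e) (^-monoˡ-≤ h q^e≤p^er^f) ⟩
      K ^ e * (p ^ e * r ^ f) ^ h           ≡⟨ cong (K ^ e *_) (^-distribʳ-* (p ^ e) (r ^ f) h) ⟩
      K ^ e * ((p ^ e) ^ h * (r ^ f) ^ h)   ≡⟨ cong (K ^ e *_) (cong₂ _*_ (^-swap p e h) (^-swap r f h)) ⟩
      K ^ e * ((p ^ h) ^ e * (r ^ h) ^ f)   ≡⟨ x∙yz≈y∙xz (K ^ e) ((p ^ h) ^ e) ((r ^ h) ^ f) ⟩
      (p ^ h) ^ e * (K ^ e * (r ^ h) ^ f)   ≤⟨ *-monoʳ-≤ ((p ^ h) ^ e) (*-monoʳ-≤ (K ^ e) (^-monoˡ-≤ f r^h≤n)) ⟩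
      (p ^ h) ^ e * (K ^ e * n ^ f)         ∎)
    where open ≤-Reasoning

open BoundingBox using (Extent; ⟨_,_,_⟩; halfWidth; above; below; SymBox; extent₁; extent₂;
                        box-leaf; box-construction₁; box-construction₂; width≤; height≤)
open Growth
open import Data.Nat
open import Data.Nat.Properties
open import Data.Integer using (+_)
open import Data.Product using (Σ; ∃; _×_; _,_)
open import Data.Unit using (tt)
open import Data.Bool using (T)
open import Relation.Binary.PropositionalEquality using (sym)

record Bounded (h : ℕ) (e w : Extent) : Set where
  field
    halfWidth≤ : suc (halfWidth e) ≤ halfWidth w ·ρ^ h
    above≤     : suc (above e) ≤ above w ·ρ^ h
    below≤     : suc (below e) ≤ below w ·ρ^ h
open Bounded

weight₁ weight₂ : Extent → Extent → Extent
weight₁ a b = ⟨ halfWidth a + (above b + below b) , halfWidth b , (above a + below a) ⊔ halfWidth b ⟩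
weight₂ a b = ⟨ (above b + below b) ⊔ halfWidth a , halfWidth b , halfWidth b + (above a + below a) ⟩

ρ-suc-+ : ∀ {x y wx wy h} → suc x ≤ wx ·ρ^ h → suc y ≤ wy ·ρ^ h → suc (suc (x + y)) ≤ wx + wy ·ρ^ h
ρ-suc-+ {x} {y} p q = ρ-mono (s≤s (≤-reflexive (sym (+-suc x y)))) (ρ-+ p q)

bounded-extent₁ : ∀ {h ea eb wa wb} → Bounded h ea wa → Bounded h eb wb →
                  Bounded h (extent₁ ea eb) (weight₁ wa wb)
bounded-extent₁ a b = record
  { halfWidth≤ = ρ-mono (s≤s (+-monoʳ-≤ _ (n≤1+n _))) (ρ-+ (halfWidth≤ a) (ρ-suc-+ (above≤ b) (below≤ b)))
  ; above≤ = halfWidth≤ b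
  ; below≤ = ρ-⊔ (ρ-suc-+ (above≤ a) (below≤ a)) (halfWidth≤ b) }

bounded-extent₂ : ∀ {h ea eb wa wb} → Bounded h ea wa → Bounded h eb wb →
                  Bounded h (extent₂ ea eb) (weight₂ wa wb)
bounded-extent₂ a b = record
  { halfWidth≤ = ρ-⊔ (ρ-suc-+ (above≤ b) (below≤ b)) (halfWidth≤ a)
  ; above≤ = halfWidth≤ b
  ; below≤ = ρ-mono (s≤s (+-monoʳ-≤ _ (n≤1+n _))) (ρ-+ (halfWidth≤ b) (ρ-suc-+ (above≤ a) (below≤ a))) }

record _≼_ (w w′ : Extent) : Set where
  constructor ≼-intro
  field
    halfWidth-≼ : 20 * halfWidth w ≤ 37 * halfWidth w′
    above-≼     : 20 * above w ≤ 37 * above w′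
    below-≼     : 20 * below w ≤ 37 * below w′

bounded-step : ∀ {h e w w′} → Bounded h e w → w ≼ w′ → Bounded (suc h) e w′
bounded-step b (≼-intro p q r) = record
  { halfWidth≤ = ρ-step (halfWidth≤ b) p ; above≤ = ρ-step (above≤ b) q ; below≤ = ρ-step (below≤ b) r }

bounded-zero : ∀ {a b c} → Bounded 0 ⟨ 0 , 0 , 0 ⟩ ⟨ suc a , suc b , suc c ⟩
bounded-zero = record { halfWidth≤ = ρ-zero (s≤s z≤n) ; above≤ = ρ-zero (s≤s z≤n) ; below≤ = ρ-zero (s≤s z≤n) }

≼-by-evaluation : ∀ {w w′} → T (20 * halfWidth w ≤ᵇ 37 * halfWidth w′) → T (20 * above w ≤ᵇ 37 * above w′) →
                  T (20 * below w ≤ᵇ 37 * below w′) → w ≼ w′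
≼-by-evaluation p q r = ≼-intro (≤ᵇ⇒≤ _ _ p) (≤ᵇ⇒≤ _ _ q) (≤ᵇ⇒≤ _ _ r)

data Kind : Set where
  κ₀ κ₁ κ₂ : Kind

origin : Point
origin = (+ 0 , + 0)

drawing : (h : ℕ) → Kind → Drawing (suc h)
drawing zero    _  = leaf origin
drawing (suc h) κ₀ = construction2 origin (drawing h κ₁) (drawing h κ₀) (drawing h κ₀)
drawing (suc h) κ₁ = construction1 origin (drawing h κ₂) (drawing h κ₀) (drawing h κ₀)
drawing (suc h) κ₂ = construction1 origin (drawing h κ₀) (drawing h κ₀) (drawing h κ₀)

oneTwo : ∀ h k → OneTwo (drawing h k)
oneTwo zero    _  = base origin
oneTwo (suc h) κ₀ = cons2 (oneTwo h κ₁) (oneTwo h κ₀) (oneTwo h κ₀) origin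
oneTwo (suc h) κ₁ = cons1 (oneTwo h κ₂) (oneTwo h κ₀) (oneTwo h κ₀) origin
oneTwo (suc h) κ₂ = cons1 (oneTwo h κ₀) (oneTwo h κ₀) (oneTwo h κ₀) origin

extent : ℕ → Kind → Extent
extent zero    _  = ⟨ 0 , 0 , 0 ⟩
extent (suc h) κ₀ = extent₂ (extent h κ₁) (extent h κ₀)
extent (suc h) κ₁ = extent₁ (extent h κ₂) (extent h κ₀)
extent (suc h) κ₂ = extent₁ (extent h κ₀) (extent h κ₀)

box : ∀ h k → SymBox (drawing h k) (extent h k)
box zero    _  = box-leaf origin
box (suc h) κ₀ = box-construction₂ origin (box h κ₁) (box h κ₀) (box h κ₀)
box (suc h) κ₁ = box-construction₁ origin (box h κ₂) (box h κ₀) (box h κ₀)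
box (suc h) κ₂ = box-construction₁ origin (box h κ₀) (box h κ₀) (box h κ₀)

-- A supersolution of the extent recurrence at growth ratio ρ: weight₁/weight₂ of it are ≼ it.
weight : Kind → Extent
weight κ₀ = ⟨ 20 , 11 , 26 ⟩
weight κ₁ = ⟨ 37 , 11 , 17 ⟩
weight κ₂ = ⟨ 31 , 11 , 20 ⟩

bounded : ∀ h k → Bounded h (extent h k) (weight k)
bounded zero    κ₀ = bounded-zero
bounded zero    κ₁ = bounded-zero
bounded zero    κ₂ = bounded-zero
bounded (suc h) κ₀ = bounded-step (bounded-extent₂ (bounded h κ₁) (bounded h κ₀)) (≼-by-evaluation tt tt tt)
bounded (suc h) κ₁ = bounded-step (bounded-extent₁ (bounded h κ₂) (bounded h κ₀)) (≼-by-evaluation tt tt tt)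
bounded (suc h) κ₂ = bounded-step (bounded-extent₁ (bounded h κ₀) (bounded h κ₀)) (≼-by-evaluation tt tt tt)

area-growth : ∀ h → 400 ^ h * area (drawing h κ₀) ≤ 1480 * 1369 ^ h
area-growth h = ρ-* width≤40 height≤37
  where
  b = bounded h κ₀
  width≤40 : width (drawing h κ₀) ≤ 40 ·ρ^ h
  width≤40 = ρ-mono (≤-trans (width≤ (box h κ₀)) (n≤1+n _)) (ρ-suc-+ (halfWidth≤ b) (halfWidth≤ b))
  height≤37 : height (drawing h κ₀) ≤ 37 ·ρ^ h
  height≤37 = ρ-mono (≤-trans (height≤ (box h κ₀)) (n≤1+n _)) (ρ-suc-+ (above≤ b) (below≤ b))

3^h≤nodes : ∀ h → 3 ^ h ≤ nodes (suc h)
3^h≤nodes zero    = s≤s z≤n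
3^h≤nodes (suc h) = ≤-trans (*-monoʳ-≤ 3 (3^h≤nodes h)) (n≤1+n _)

-- ρ² = 1369/400, and log₃ (1369/400) < 1.149.
exponent-ratio : 1369 ^ 1000 ≤ 400 ^ 1000 * 3 ^ 1149
exponent-ratio = ≤ᵇ⇒≤ (1369 ^ 1000) (400 ^ 1000 * 3 ^ 1149) tt


theorem3 : ∃ λ (C : ℕ) → ∀ (h : ℕ) → Σ (Drawing (suc h)) λ d →
             OneTwo d × (area d ^ 1000 ≤ C * nodes (suc h) ^ 1149)
theorem3 = 1480 ^ 1000 , λ h → drawing h κ₀ , oneTwo h κ₀ ,
  ^-transfer {400} {1369} {3} {1000} {1149} {h} {area (drawing h κ₀)} {1480} {nodes (suc h)}
    (area-growth h) exponent-ratio (3^h≤nodes h)
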